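{- For every finite or infinite sequence $\mathbf f$ over $\{ -1,1\}$, the only nonempty palindromes that can occur as factors of the run-length sequence $R_{\mathbf f}$ are $1, 2, 3, 22, 212, 232, 12321$, and $32123$.
   Context: For a finite sequence $\mathbf f$ over $\{ -1,1\}$ define $P_\epsilon=\epsilon$ (empty) and $P_{\mathbf f a}=P_{\mathbf f}\ a\ (-P_{\mathbf f}^R)$ for $a\in\{ -1,1\}$, where $-x$ negates every entry and $x^R$ is reversal. For an infinite $\mathbf f=f_0f_1\cdots$, $P_{\mathbf f}$ is the unique infinite sequence having every $P_{f_0\cdots f_n}$ as a prefix. A run is a maximal block of consecutive identical entries; the run-length sequence $R_{\mathbf f}$ is the sequence of lengths of the runs of $P_{\mathbf f}$ from left to right (a word over $\{1,2,3\}$). A factor is a contiguous block; a palindrome is a word equal to its reversal. -}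

module Defs where

open import Data.Nat using (ℕ; zero; suc; _+_; _≤_; _<_)
open import Data.List using (List; []; _∷_; _++_; map; reverse; foldl; applyUpTo)
open import Data.Sign using (Sign; opposite)
import Data.Sign
import Data.Unit
import Relation.Nullary
open import Data.Product using (∃; _×_)
open import Data.Sum using (_⊎_)
open import Relation.Binary.PropositionalEquality using (_≡_; _≢_)

-- The alphabet {-1,1} is represented by Data.Sign.Sign (- and +);
-- negation of an entry is `opposite`.

negate : List Sign → List Sign
negate = map opposite

foldStep : List Sign → Sign → List Sign
foldStep p a = p ++ (a ∷ negate (reverse p))

P : List Sign → List Sign
P f = foldl foldStep [] f

runsAux : Sign → ℕ → List Sign → List ℕ
runsAux c k [] = k ∷ []
runsAux c k (x ∷ xs) with Data.Sign._≟_ c x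
... | Relation.Nullary.yes _ = runsAux c (suc k) xs
... | Relation.Nullary.no  _ = k ∷ runsAux x 1 xs

runLengths : List Sign → List ℕ
runLengths [] = []
runLengths (x ∷ xs) = runsAux x 1 xs

R : List Sign → List ℕ
R f = runLengths (P f)

at : {A : Set} → A → List A → ℕ → A
at d [] i = d
at d (x ∷ xs) zero = x
at d (x ∷ xs) (suc i) = at d xs i

-- P_f for infinite f : ℕ → Sign. The prefix P_{f_0...f_i} has length
-- 2^(i+1) - 1 > i, so the default is never used.
P∞ : (ℕ → Sign) → ℕ → Sign
P∞ f i = at Sign.+ (P (applyUpTo f (suc i))) i

-- For an infinite sequence s, `Blocks s i w` says: starting at position i,
-- s consists of consecutive maximal-to-the-right runs of lengths given by w,
-- i.e. each block of length l ≥ 1 is constant and the entry after it differs.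
Constant : (ℕ → Sign) → ℕ → ℕ → Set
Constant s i l = ∀ j → j < l → s (i + j) ≡ s i

data Blocks (s : ℕ → Sign) : ℕ → List ℕ → Set where
  done : ∀ {i} → Blocks s i []
  block : ∀ {i l w} → 1 ≤ l → Constant s i l → s (i + l) ≢ s i →
          Blocks s (i + l) w → Blocks s i (l ∷ w)

RunStart : (ℕ → Sign) → ℕ → Set
RunStart s zero = Data.Unit.⊤
RunStart s (suc i) = s i ≢ s (suc i)

FactorOfRuns∞ : List ℕ → (ℕ → Sign) → Set
FactorOfRuns∞ w s = ∃ λ i → RunStart s i × Blocks s i w

Palindrome : List ℕ → Set
Palindrome w = w ≡ reverse w

allowed : List (List ℕ)
allowed = (1 ∷ []) ∷ (2 ∷ []) ∷ (3 ∷ []) ∷ (2 ∷ 2 ∷ []) ∷ (2 ∷ 1 ∷ 2 ∷ [])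
        ∷ (2 ∷ 3 ∷ 2 ∷ []) ∷ (1 ∷ 2 ∷ 3 ∷ 2 ∷ 1 ∷ []) ∷ (3 ∷ 2 ∷ 1 ∷ 2 ∷ 3 ∷ []) ∷ []

Factor : {A : Set} → List A → List A → Set
Factor w x = ∃ λ u → ∃ λ v → u ++ (w ++ v) ≡ x

-- P_{f₀f₁⋯} interleaves the alternating signs f₀, −f₀, f₀, … (even positions) with
-- P_{f₁f₂⋯} (odd positions). Hence no run is longer than 3, and, iterating four times,
-- the 47 entries of P_f from position 16q on are determined by six signs. Checking the
-- 64 resulting windows shows that every palindromic run-length factor of length at most 7
-- is one of the eight listed words. A longer palindrome would contain, after removing
-- its first and last run, a palindromic run-length factor of length at least 6, which
-- cannot exist. A finite f reduces to the infinite case: extended by a sign that closes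
-- the last run of P_f, it yields an infinite P whose runs start with those of P_f.
module Submission where

open import Defs
open import Data.Empty using (⊥-elim)
open import Data.List
  using (List; []; _∷_; _++_; _∷ʳ_; [_]; reverse; foldl; applyUpTo; length; initLast; _∷ʳ′_)
import Data.List.Properties as List
open import Data.List.Membership.Propositional using (_∈_)
open import Data.List.Relation.Unary.All as All using (All; []; _∷_)
open import Data.Nat using (ℕ; zero; suc; _+_; _*_; _≤_; _<_; z≤n; s≤s; _≤?_; _/_; _%_)
import Data.Nat as ℕ
open import Data.List.Membership.DecPropositional (List.≡-dec ℕ._≟_) using (_∈?_)
open import Data.Nat.DivMod using (m%n<n; m≡m%n+[m/n]*n)
open import Data.Nat.ListAction using (sum)
open import Data.Nat.Properties
  using (+-suc; +-assoc; +-comm; +-identityʳ; ≤-refl; ≤-reflexive; ≤-trans; ≤-pred; ≤-total;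
         <-trans; <-≤-trans; ≤-<-trans; <⇒≤; ≰⇒>; m≤m+n; m≤n⇒m<n∨m≡n; m≤n⇒∃[o]m+o≡n;
         +-mono-≤; +-monoˡ-≤; +-monoʳ-<; *-monoˡ-≤; allUpTo?; module ≤-Reasoning)
open import Data.Nat.Tactic.RingSolver using (solve-∀)
open import Data.Product using (∃; ∃₂; _×_; _,_; proj₁; proj₂)
open import Data.Sign using (Sign; opposite)
import Data.Sign as S
open import Data.Sign.Properties using (opposite-involutive; s≢opposite[s])
open import Data.Sum using (inj₁; inj₂)
open import Data.Unit using (tt)
open import Function using (_∘_)
open import Relation.Nullary using (Dec; yes; no; ¬_; ¬?)
open import Relation.Nullary.Decidable using (toWitness; _→-dec_)
open import Relation.Binary.PropositionalEquality
  using (_≡_; _≢_; refl; sym; trans; cong; cong₂; subst; _≗_; module ≡-Reasoning)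

-- Folding as interleaving

flips : ℕ → Sign → Sign
flips zero    a = a
flips (suc n) a = flips n (opposite a)

flips-opposite : ∀ n a → flips n (opposite a) ≡ opposite (flips n a)
flips-opposite zero    a = refl
flips-opposite (suc n) a = flips-opposite n (opposite a)

flips-involutive : ∀ n a → flips n (flips n a) ≡ a
flips-involutive zero    a = refl
flips-involutive (suc n) a = begin
  flips n (opposite (flips n (opposite a))) ≡⟨ cong (flips n ∘ opposite) (flips-opposite n a) ⟩
  flips n (opposite (opposite (flips n a))) ≡⟨ cong (flips n) (opposite-involutive _) ⟩
  flips n (flips n a)                       ≡⟨ flips-involutive n a ⟩
  a                                         ∎
  where open ≡-Reasoning

weave : Sign → List Sign → List Sign
weave a []       = a ∷ []
weave a (x ∷ xs) = a ∷ x ∷ weave (opposite a) xs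

weave-++ : ∀ a p c v →
           weave a (p ++ c ∷ v) ≡ weave a p ++ c ∷ weave (opposite (flips (length p) a)) v
weave-++ a []      c v = refl
weave-++ a (x ∷ p) c v = cong (λ z → a ∷ x ∷ z) (weave-++ (opposite a) p c v)

reverse-weave : ∀ a p → reverse (weave a p) ≡ weave (flips (length p) a) (reverse p)
reverse-weave a []      = refl
reverse-weave a (x ∷ p) = begin
  reverse (a ∷ x ∷ weave a′ p)           ≡⟨ List.reverse-++ (a ∷ x ∷ []) (weave a′ p) ⟩
  reverse (weave a′ p) ++ x ∷ a ∷ []     ≡⟨ cong (_++ x ∷ a ∷ []) (reverse-weave a′ p) ⟩
  weave b (reverse p) ++ x ∷ [ a ]       ≡⟨ cong (λ z → weave b (reverse p) ++ x ∷ [ z ]) last-sign ⟨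
  weave b (reverse p) ++ x ∷ weave (opposite (flips (length (reverse p)) b)) []
                                         ≡⟨ weave-++ b (reverse p) x [] ⟨
  weave b (reverse p ∷ʳ x)               ≡⟨ cong (weave b) (List.unfold-reverse x p) ⟨
  weave b (reverse (x ∷ p))              ∎
  where
  open ≡-Reasoning
  a′ = opposite a
  b  = flips (length p) a′
  last-sign : opposite (flips (length (reverse p)) b) ≡ a
  last-sign = begin
    opposite (flips (length (reverse p)) b)
      ≡⟨ cong (λ n → opposite (flips n b)) (List.length-reverse p) ⟩
    opposite (flips (length p) b) ≡⟨ cong opposite (flips-involutive (length p) a′) ⟩
    opposite a′                   ≡⟨ opposite-involutive a ⟩
    a                             ∎

negate-weave : ∀ a p → negate (weave a p) ≡ weave (opposite a) (negate p)
negate-weave a []      = refl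
negate-weave a (x ∷ p) = cong (λ z → opposite a ∷ opposite x ∷ z) (negate-weave (opposite a) p)

foldStep-weave : ∀ a p c → foldStep (weave a p) c ≡ weave a (foldStep p c)
foldStep-weave a p c = begin
  weave a p ++ c ∷ negate (reverse (weave a p))
    ≡⟨ cong (λ z → weave a p ++ c ∷ negate z) (reverse-weave a p) ⟩
  weave a p ++ c ∷ negate (weave (flips (length p) a) (reverse p))
    ≡⟨ cong (λ z → weave a p ++ c ∷ z) (negate-weave _ (reverse p)) ⟩
  weave a p ++ c ∷ weave (opposite (flips (length p) a)) (negate (reverse p))
    ≡⟨ weave-++ a p c _ ⟨
  weave a (p ++ c ∷ negate (reverse p))
    ∎
  where open ≡-Reasoning

foldl-foldStep-weave : ∀ a p f → foldl foldStep (weave a p) f ≡ weave a (foldl foldStep p f)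
foldl-foldStep-weave a p []      = refl
foldl-foldStep-weave a p (c ∷ f) =
  trans (cong (λ z → foldl foldStep z f) (foldStep-weave a p c))
        (foldl-foldStep-weave a (foldStep p c) f)

P-∷ : ∀ a f → P (a ∷ f) ≡ weave a (P f)
P-∷ a f = foldl-foldStep-weave a [] f

length-foldStep : ∀ p c → length p < length (foldStep p c)
length-foldStep p c = begin-strict
  length p                                     <⟨ m≤m+n (suc (length p)) _ ⟩
  suc (length p) + length (negate (reverse p)) ≡⟨ +-suc (length p) _ ⟨
  length p + length (c ∷ negate (reverse p))   ≡⟨ List.length-++ p ⟨
  length (foldStep p c)                        ∎
  where open ≤-Reasoning

length-foldl-foldStep : ∀ p f → length p + length f ≤ length (foldl foldStep p f)
length-foldl-foldStep p []      = ≤-reflexive (+-identityʳ (length p))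
length-foldl-foldStep p (c ∷ f) = ≤-trans (≤-reflexive (+-suc (length p) (length f)))
  (≤-trans (+-monoˡ-≤ (length f) (length-foldStep p c)) (length-foldl-foldStep (foldStep p c) f))

P-upTo : (ℕ → Sign) → ℕ → List Sign
P-upTo g n = P (applyUpTo g n)

P-upTo-suc : ∀ g n → P-upTo g (suc n) ≡ foldStep (P-upTo g n) (g n)
P-upTo-suc g n = begin
  P (applyUpTo g (suc n))       ≡⟨ cong P (List.applyUpTo-∷ʳ g n) ⟨
  P (applyUpTo g n ∷ʳ g n)      ≡⟨ List.foldl-∷ʳ foldStep [] (g n) (applyUpTo g n) ⟩
  foldStep (P-upTo g n) (g n)   ∎
  where open ≡-Reasoning

P-upTo-++ : ∀ g n k → ∃ λ v → P-upTo g (n + k) ≡ P-upTo g n ++ v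
P-upTo-++ g n zero    rewrite +-identityʳ n = [] , sym (List.++-identityʳ _)
P-upTo-++ g n (suc k) rewrite +-suc n k with P-upTo-++ g n k
... | v , eq = v ++ g (n + k) ∷ negate (reverse (P-upTo g (n + k))) ,
  trans (P-upTo-suc g (n + k)) (trans (cong (_++ _) eq) (List.++-assoc (P-upTo g n) v _))

n≤length-P-upTo : ∀ g n → n ≤ length (P-upTo g n)
n≤length-P-upTo g n =
  subst (_≤ length (P-upTo g n)) (List.length-applyUpTo g n) (length-foldl-foldStep [] (applyUpTo g n))

at-++ˡ : ∀ {A : Set} (d : A) u v {i} → i < length u → at d (u ++ v) i ≡ at d u i
at-++ˡ d (x ∷ u) v {zero}  _        = refl
at-++ˡ d (x ∷ u) v {suc i} (s≤s i<) = at-++ˡ d u v i<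

at-P-upTo-mono : ∀ g {m n i} → m ≤ n → i < length (P-upTo g m) →
                 at S.+ (P-upTo g n) i ≡ at S.+ (P-upTo g m) i
at-P-upTo-mono g {m} m≤n i< with m≤n⇒∃[o]m+o≡n m≤n
... | k , refl with P-upTo-++ g m k
...   | v , eq rewrite eq = at-++ˡ S.+ (P-upTo g m) v i<

P∞-agrees : ∀ g n i → i < length (P-upTo g n) → P∞ g i ≡ at S.+ (P-upTo g n) i
P∞-agrees g n i i< with ≤-total (suc i) n
... | inj₁ 1+i≤n = sym (at-P-upTo-mono g 1+i≤n (n≤length-P-upTo g (suc i)))
... | inj₂ n≤1+i = at-P-upTo-mono g n≤1+i i<

interleave : Sign → (ℕ → Sign) → ℕ → Sign
interleave b r zero          = b
interleave b r (suc zero)    = r zero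
interleave b r (suc (suc t)) = interleave (opposite b) (r ∘ suc) t

AgreeBelow : ℕ → (ℕ → Sign) → (ℕ → Sign) → Set
AgreeBelow N s s′ = ∀ t → t < N → s t ≡ s′ t

at-weave : ∀ d a p i → i ≤ length p + length p → at d (weave a p) i ≡ interleave a (at d p) i
at-weave d a []      zero          _        = refl
at-weave d a (x ∷ p) zero          _        = refl
at-weave d a (x ∷ p) (suc zero)    _        = refl
at-weave d a (x ∷ p) (suc (suc i)) (s≤s i<) =
  at-weave d (opposite a) p i (≤-pred (subst (suc i ≤_) (+-suc (length p) (length p)) i<))

interleave-agree : ∀ {N r r′} b → AgreeBelow N r r′ →
                   AgreeBelow (suc (N + N)) (interleave b r) (interleave b r′)
interleave-agree         b agree zero          _              = refl
interleave-agree {suc N} b agree (suc zero)    _              = agree zero (s≤s z≤n)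
interleave-agree {suc N} b agree (suc (suc t)) (s≤s (s≤s t<)) =
  interleave-agree (opposite b) (λ u u< → agree (suc u) (s≤s u<)) t (subst (t <_) (+-suc N N) t<)
interleave-agree {zero}  b agree (suc _)       (s≤s ())

interleave-shift : ∀ b r m t → interleave b r (m + m + t) ≡ interleave (flips m b) (λ u → r (m + u)) t
interleave-shift b r zero    t = refl
interleave-shift b r (suc m) t =
  trans (cong (interleave b r ∘ suc) (cong (_+ t) (+-suc m m)))
        (interleave-shift (opposite b) (r ∘ suc) m t)

interleave-¬Constant4 : ∀ b r i → ¬ Constant (interleave b r) i 4
interleave-¬Constant4 b r zero          c = s≢opposite[s] b (sym (c 2 (s≤s (s≤s (s≤s z≤n)))))
interleave-¬Constant4 b r (suc zero)    c =
  s≢opposite[s] (opposite b) (trans (c 1 (s≤s (s≤s z≤n))) (sym (c 3 ≤-refl)))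
interleave-¬Constant4 b r (suc (suc i)) c = interleave-¬Constant4 (opposite b) (r ∘ suc) i c

P∞-interleave : ∀ g → P∞ g ≗ interleave (g 0) (P∞ (g ∘ suc))
P∞-interleave g i = begin
  at S.+ (P (g 0 ∷ applyUpTo (g ∘ suc) i)) i
    ≡⟨ cong (λ p → at S.+ p i) (P-∷ (g 0) (applyUpTo (g ∘ suc) i)) ⟩
  at S.+ (weave (g 0) (P-upTo (g ∘ suc) i)) i
    ≡⟨ at-weave S.+ (g 0) (P-upTo (g ∘ suc) i) i (≤-trans i≤ (m≤m+n _ _)) ⟩
  interleave (g 0) (at S.+ (P-upTo (g ∘ suc) i)) i
    ≡⟨ interleave-agree (g 0) prefix i (s≤s (m≤m+n i i)) ⟩
  interleave (g 0) (P∞ (g ∘ suc)) i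
    ∎
  where
  open ≡-Reasoning
  i≤ = n≤length-P-upTo (g ∘ suc) i
  prefix : AgreeBelow i (at S.+ (P-upTo (g ∘ suc) i)) (P∞ (g ∘ suc))
  prefix u u<i = sym (P∞-agrees (g ∘ suc) i u (<-≤-trans u<i i≤))

P∞-agreeBelow-interleave : ∀ g m {N r} → AgreeBelow N (λ u → P∞ (g ∘ suc) (m + u)) r →
                           AgreeBelow (suc (N + N)) (λ t → P∞ g (m + m + t)) (interleave (flips m (g 0)) r)
P∞-agreeBelow-interleave g m {r = r} agree t t< = begin
  P∞ g (m + m + t)                                          ≡⟨ P∞-interleave g (m + m + t) ⟩
  interleave (g 0) (P∞ (g ∘ suc)) (m + m + t)               ≡⟨ interleave-shift (g 0) _ m t ⟩
  interleave (flips m (g 0)) (λ u → P∞ (g ∘ suc) (m + u)) t ≡⟨ interleave-agree _ agree t t< ⟩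
  interleave (flips m (g 0)) r t                            ∎
  where open ≡-Reasoning

P∞-run≤3 : ∀ g {i l} → Constant (P∞ g) i l → l ≤ 3
P∞-run≤3 g {i} {l} c with l ≤? 3
... | yes l≤3 = l≤3
... | no  l≰3 = ⊥-elim (interleave-¬Constant4 (g 0) (P∞ (g ∘ suc)) i c₄)
  where
  c₄ : Constant (interleave (g 0) (P∞ (g ∘ suc))) i 4
  c₄ j j<4 = trans (sym (P∞-interleave g (i + j)))
                   (trans (c j (<-≤-trans j<4 (≰⇒> l≰3))) (P∞-interleave g i))

P∞-Blocks-≤3 : ∀ g {i w} → Blocks (P∞ g) i w → All (_≤ 3) w
P∞-Blocks-≤3 g     done                             = []
P∞-Blocks-≤3 g {i} (block {l = l} _ const _ rest) = P∞-run≤3 g {i} {l} const ∷ P∞-Blocks-≤3 g rest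

Blocks-shift : ∀ {s} c {j w} → Blocks s (c + j) w → Blocks (λ t → s (c + t)) j w
Blocks-shift c done = done
Blocks-shift {s} c {j} (block {l = l} {w} 1≤l const ne rest) =
  block 1≤l (λ k k< → trans (cong s (sym (+-assoc c j k))) (const k k<))
        (λ e → ne (trans (cong s (+-assoc c j l)) e))
        (Blocks-shift c (subst (λ p → Blocks s p w) (+-assoc c j l) rest))

Blocks-transfer : ∀ {s s′ M j w} → AgreeBelow M s s′ → j + sum w < M → Blocks s j w → Blocks s′ j w
Blocks-transfer agree bound done = done
Blocks-transfer {M = M} {j} {l ∷ w} agree bound (block 1≤l const ne rest) =
  block 1≤l (λ k k< → trans (sym (agree (j + k) (<-trans (+-monoʳ-< j k<) j+l<)))
                            (trans (const k k<) (agree j j<)))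
        (λ e → ne (trans (agree (j + l) j+l<) (trans e (sym (agree j j<)))))
        (Blocks-transfer agree j+l+w< rest)
  where
  j+l+w< : j + l + sum w < M
  j+l+w< = subst (_< M) (sym (+-assoc j l (sum w))) bound
  j+l< : j + l < M
  j+l< = ≤-<-trans (m≤m+n (j + l) (sum w)) j+l+w<
  j< : j < M
  j< = ≤-<-trans (m≤m+n j l) j+l<

RunStart-shift : ∀ {s} c t → RunStart s (c + t) → RunStart (λ u → s (c + u)) t
RunStart-shift     c zero    _    = tt
RunStart-shift {s} c (suc t) rs e = subst (RunStart s) (+-suc c t) rs (trans e (cong s (+-suc c t)))

RunStart-transfer : ∀ {s s′ M t} → AgreeBelow M s s′ → t < M → RunStart s t → RunStart s′ t
RunStart-transfer {t = zero}  agree t< rs   = tt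
RunStart-transfer {t = suc t} agree t< rs e =
  rs (trans (agree t (<⇒≤ t<)) (trans e (sym (agree (suc t) t<))))

Blocks-++ˡ : ∀ {s i} u {v} → Blocks s i (u ++ v) → Blocks s i u
Blocks-++ˡ []      b                         = done
Blocks-++ˡ (l ∷ u) (block 1≤l const ne rest) = block 1≤l const ne (Blocks-++ˡ u rest)

Blocks-RunStart : ∀ {s i l w} → Blocks s i (l ∷ w) → RunStart s (i + l)
Blocks-RunStart {s} {i} (block {l = suc l} _ const ne _) = subst (RunStart s) (sym (+-suc i l))
  (λ e → ne (trans (cong s (+-suc i l)) (trans (sym e) (const l ≤-refl))))

FactorOfRuns∞-++ˡ : ∀ {s} u {v} → FactorOfRuns∞ (u ++ v) s → FactorOfRuns∞ u s
FactorOfRuns∞-++ˡ u (i , rs , b) = i , rs , Blocks-++ˡ u b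

FactorOfRuns∞-++ʳ : ∀ {s} u {v} → FactorOfRuns∞ (u ++ v) s → FactorOfRuns∞ v s
FactorOfRuns∞-++ʳ []      fac                            = fac
FactorOfRuns∞-++ʳ (l ∷ u) (i , _ , b@(block _ _ _ rest)) =
  FactorOfRuns∞-++ʳ u (i + l , Blocks-RunStart b , rest)

-- Looks at most two entries ahead, so it is correct only for runs of length at most 3.
runLength : (ℕ → Sign) → ℕ → ℕ
runLength s j with s (j + 1) S.≟ s j | s (j + 2) S.≟ s j
... | no  _ | _     = 1
... | yes _ | no  _ = 2
... | yes _ | yes _ = 3

runsFrom : (ℕ → Sign) → ℕ → ℕ → List ℕ
runsFrom s j zero    = []
runsFrom s j (suc n) = runLength s j ∷ runsFrom s (j + runLength s j) n

runLength-unique : ∀ {s j l} → 1 ≤ l → l ≤ 3 → Constant s j l → s (j + l) ≢ s j → runLength s j ≡ l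
runLength-unique {s} {j} {1} _ _ _ ne with s (j + 1) S.≟ s j
... | yes e = ⊥-elim (ne e)
... | no  _ = refl
runLength-unique {s} {j} {2} _ _ c ne with s (j + 1) S.≟ s j | s (j + 2) S.≟ s j
... | no  n₁ | _     = ⊥-elim (n₁ (c 1 (s≤s (s≤s z≤n))))
... | yes _  | no  _ = refl
... | yes _  | yes e = ⊥-elim (ne e)
runLength-unique {s} {j} {3} _ _ c ne with s (j + 1) S.≟ s j | s (j + 2) S.≟ s j
... | no  n₁ | _      = ⊥-elim (n₁ (c 1 (s≤s (s≤s z≤n))))
... | yes _  | no  n₂ = ⊥-elim (n₂ (c 2 (s≤s (s≤s (s≤s z≤n)))))
... | yes _  | yes _  = refl
runLength-unique {l = suc (suc (suc (suc _)))} _ (s≤s (s≤s (s≤s ()))) _ _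

Blocks⇒runsFrom : ∀ {s j w} → Blocks s j w → All (_≤ 3) w → w ≡ runsFrom s j (length w)
Blocks⇒runsFrom done [] = refl
Blocks⇒runsFrom {s} {j} (block 1≤l const ne rest) (l≤3 ∷ ≤3s) =
  cong₂ _∷_ (sym length≡)
            (trans (Blocks⇒runsFrom rest ≤3s) (cong (λ l → runsFrom s (j + l) _) (sym length≡)))
  where length≡ = runLength-unique 1≤l l≤3 const ne

sum≤3*length : ∀ {w} → All (_≤ 3) w → sum w ≤ length w * 3
sum≤3*length []          = z≤n
sum≤3*length (l≤3 ∷ ≤3s) = +-mono-≤ l≤3 (sum≤3*length ≤3s)

-- Short palindromes, by checking all windows

PalindromeAllowed : List ℕ → Set
PalindromeAllowed w = w ≢ [] → Palindrome w → w ∈ allowed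

palindromeAllowed? : ∀ w → Dec (PalindromeAllowed w)
palindromeAllowed? w = ¬? (w ≟ []) →-dec ((w ≟ reverse w) →-dec (w ∈? allowed))
  where _≟_ = List.≡-dec ℕ._≟_

runStart? : ∀ s i → Dec (RunStart s i)
runStart? s zero    = yes tt
runStart? s (suc i) = ¬? (s i S.≟ s (suc i))

WindowOK : (ℕ → Sign) → Set
WindowOK h = ∀ {t} → t < 16 → ∀ {n} → n < 8 → RunStart h t → PalindromeAllowed (runsFrom h t n)

windowOK? : ∀ h → Dec (WindowOK h)
windowOK? h =
  allUpTo? (λ t → allUpTo? (λ n → runStart? h t →-dec palindromeAllowed? (runsFrom h t n)) 8) 16

allSigns? : {P : Sign → Set} → (∀ s → Dec (P s)) → Dec (∀ s → P s)
allSigns? P? with P? S.+ | P? S.-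
... | yes p₊ | yes p₋ = yes λ { S.+ → p₊ ; S.- → p₋ }
... | no ¬p₊ | _      = no λ p → ¬p₊ (p S.+)
... | yes _  | no ¬p₋ = no λ p → ¬p₋ (p S.-)

pair : Sign → Sign → ℕ → Sign
pair c₀ c₁ zero    = c₀
pair c₀ c₁ (suc _) = c₁

pair-agrees : ∀ s → AgreeBelow 2 s (pair (s 0) (s 1))
pair-agrees s zero          _              = refl
pair-agrees s (suc zero)    _              = refl
pair-agrees s (suc (suc _)) (s≤s (s≤s ()))

model : Sign → Sign → Sign → Sign → Sign → Sign → ℕ → Sign
model b₀ b₁ b₂ b₃ c₀ c₁ = interleave b₀ (interleave b₁ (interleave b₂ (interleave b₃ (pair c₀ c₁))))

model-windowOK : ∀ b₀ b₁ b₂ b₃ c₀ c₁ → WindowOK (model b₀ b₁ b₂ b₃ c₀ c₁)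
model-windowOK = toWitness {a? = allSigns? λ b₀ → allSigns? λ b₁ → allSigns? λ b₂ → allSigns? λ b₃ →
                                 allSigns? λ c₀ → allSigns? λ c₁ → windowOK? (model b₀ b₁ b₂ b₃ c₀ c₁)} tt

double : ℕ → ℕ
double n = n + n

sixteen : ℕ → ℕ
sixteen q = double (double (double (double q)))

localModel : (ℕ → Sign) → ℕ → ℕ → Sign
localModel f q = model (flips (double (double (double q))) (f 0)) (flips (double (double q)) (f 1))
                       (flips (double q) (f 2)) (flips q (f 3))
                       (P∞ (f ∘ (4 +_)) (q + 0)) (P∞ (f ∘ (4 +_)) (q + 1))

P∞-localModel : ∀ f q → AgreeBelow 47 (λ t → P∞ f (sixteen q + t)) (localModel f q)
P∞-localModel f q =
  P∞-agreeBelow-interleave f (double (double (double q))) (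
  P∞-agreeBelow-interleave (f ∘ suc) (double (double q)) (
  P∞-agreeBelow-interleave (f ∘ suc ∘ suc) (double q) (
  P∞-agreeBelow-interleave (f ∘ suc ∘ suc ∘ suc) q (
  pair-agrees (λ u → P∞ (f ∘ (4 +_)) (q + u))))))

localModel-windowOK : ∀ f q → WindowOK (localModel f q)
localModel-windowOK f q = model-windowOK _ _ _ _ _ _

divMod16 : ∀ i → ∃₂ λ q t → t < 16 × i ≡ sixteen q + t
divMod16 i = i / 16 , i % 16 , m%n<n i 16 , (begin
  i                         ≡⟨ m≡m%n+[m/n]*n i 16 ⟩
  i % 16 + i / 16 * 16      ≡⟨ +-comm (i % 16) _ ⟩
  i / 16 * 16 + i % 16      ≡⟨ cong (_+ i % 16) (*16≡sixteen (i / 16)) ⟩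
  sixteen (i / 16) + i % 16 ∎)
  where
  open ≡-Reasoning
  *16≡sixteen : ∀ q → q * 16 ≡ q + q + (q + q) + (q + q + (q + q)) + (q + q + (q + q) + (q + q + (q + q)))
  *16≡sixteen = solve-∀

RunStart-localModel : ∀ f q {t} → t < 16 → RunStart (P∞ f) (sixteen q + t) → RunStart (localModel f q) t
RunStart-localModel f q {t} t<16 rs = RunStart-transfer {M = 47} (P∞-localModel f q)
  (≤-trans t<16 (m≤m+n 16 31)) (RunStart-shift {P∞ f} (sixteen q) t rs)

Blocks-localModel : ∀ f q {t w} → t < 16 → length w ≤ 7 →
                    Blocks (P∞ f) (sixteen q + t) w → Blocks (localModel f q) t w
Blocks-localModel f q {t} {w} t<16 |w|≤7 b =
  Blocks-transfer {M = 47} (P∞-localModel f q) bound (Blocks-shift {P∞ f} (sixteen q) b)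
  where
  bound : t + sum w < 47
  bound = ≤-trans (s≤s (+-mono-≤ (≤-pred t<16) (≤-trans (sum≤3*length (P∞-Blocks-≤3 f b))
                                                          (*-monoˡ-≤ 3 |w|≤7))))
                  (m≤m+n 37 10)

short-runFactor-palindromeAllowed : ∀ f w → length w ≤ 7 → FactorOfRuns∞ w (P∞ f) → PalindromeAllowed w
short-runFactor-palindromeAllowed f w |w|≤7 (i , rs , b) = inWindow (divMod16 i)
  where
  -- A local function rather than `with`: abstracting over divMod16 i makes Agda unfold the division.
  inWindow : (∃₂ λ q t → t < 16 × i ≡ sixteen q + t) → PalindromeAllowed w
  inWindow (q , t , t<16 , refl) = subst PalindromeAllowed (sym w≡runs)
    (localModel-windowOK f q {t} t<16 {length w} (s≤s |w|≤7) (RunStart-localModel f q t<16 rs))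
    where
    w≡runs : w ≡ runsFrom (localModel f q) t (length w)
    w≡runs = Blocks⇒runsFrom (Blocks-localModel f q t<16 |w|≤7 b) (P∞-Blocks-≤3 f b)

-- Long palindromes

Palindrome-inner : ∀ x w y → Palindrome (x ∷ (w ∷ʳ y)) → Palindrome w
Palindrome-inner x w y pal =
  proj₁ (List.∷ʳ-injective w (reverse w) (proj₂ (List.∷-injective (trans pal reverse-ends))))
  where
  open ≡-Reasoning
  reverse-ends : reverse (x ∷ (w ∷ʳ y)) ≡ y ∷ (reverse w ∷ʳ x)
  reverse-ends = begin
    reverse (x ∷ (w ∷ʳ y)) ≡⟨ List.unfold-reverse x (w ∷ʳ y) ⟩
    reverse (w ∷ʳ y) ∷ʳ x  ≡⟨ cong (_∷ʳ x) (List.reverse-++ w [ y ]) ⟩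
    y ∷ (reverse w ∷ʳ x)   ∎

allowed-length≤5 : ∀ {w} → w ∈ allowed → length w ≤ 5
allowed-length≤5 = All.lookup (toWitness {a? = All.all? (λ w → length w ≤? 5) allowed} tt)

PalindromeAllowed-extend : ∀ x w y → ¬ length w ≤ 5 → PalindromeAllowed w →
                           PalindromeAllowed (x ∷ (w ∷ʳ y))
PalindromeAllowed-extend x w y long allowedʷ _ pal =
  ⊥-elim (long (allowed-length≤5 (allowedʷ w≢[] (Palindrome-inner x w y pal))))
  where
  w≢[] : w ≢ []
  w≢[] refl = long z≤n

runFactor-palindromeAllowed : ∀ n f w → length w ≤ n → FactorOfRuns∞ w (P∞ f) → PalindromeAllowed w
runFactor-palindromeAllowed n f w |w|≤n fac with length w ≤? 7
... | yes |w|≤7 = short-runFactor-palindromeAllowed f w |w|≤7 fac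
runFactor-palindromeAllowed (suc n) f (x ∷ u) (s≤s |u|≤n) fac | no |w|≰7 with initLast u
... | []      = ⊥-elim (|w|≰7 (s≤s z≤n))
... | w ∷ʳ′ y = PalindromeAllowed-extend x w y long
                  (runFactor-palindromeAllowed n f w (≤-trans (List.length-++-≤ˡ w) |u|≤n) inner)
  where
  inner = FactorOfRuns∞-++ˡ w (FactorOfRuns∞-++ʳ [ x ] fac)
  long : ¬ length w ≤ 5
  long |w|≤5 = |w|≰7 (s≤s (subst (_≤ 6) (sym (List.length-++ w)) (+-monoˡ-≤ 1 |w|≤5)))
runFactor-palindromeAllowed zero f (x ∷ u) () fac | no _
runFactor-palindromeAllowed n    f []      _  fac | no |w|≰7 = ⊥-elim (|w|≰7 z≤n)

P∞-palindromic-runFactor-allowed : ∀ f w → w ≢ [] → Palindrome w → FactorOfRuns∞ w (P∞ f) → w ∈ allowed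
P∞-palindromic-runFactor-allowed f w w≢[] pal fac =
  runFactor-palindromeAllowed (length w) f w ≤-refl fac w≢[] pal

-- Finite sequences

lastOr : Sign → List Sign → Sign
lastOr c []       = c
lastOr _ (y ∷ ys) = lastOr y ys

Blocks-runsAux : ∀ {s k c n} ys → 1 ≤ n → s k ≡ c → Constant s k n →
                 (∀ i → i < length ys → s (k + n + i) ≡ at S.+ ys i) →
                 s (k + n + length ys) ≢ lastOr c ys → Blocks s k (runsAux c n ys)
Blocks-runsAux {s} {k} {c} {n} [] 1≤n sk≡c const _ ne =
  block 1≤n const (λ e → ne (trans (cong s (+-identityʳ _)) (trans e sk≡c))) done
Blocks-runsAux {s} {k} {c} {n} (y ∷ ys) 1≤n sk≡c const agree ne with c S.≟ y
... | yes refl =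
  Blocks-runsAux ys (s≤s z≤n) sk≡c const′ (λ i i< → trans (cong s (shift i)) (agree (suc i) (s≤s i<)))
                 (λ e → ne (trans (cong s (sym (shift (length ys)))) e))
  where
  shift : ∀ i → k + suc n + i ≡ k + n + suc i
  shift i = trans (cong (_+ i) (+-suc k n)) (sym (+-suc (k + n) i))
  const′ : Constant s k (suc n)
  const′ j j< with m≤n⇒m<n∨m≡n (≤-pred j<)
  ... | inj₁ j<n  = const j j<n
  ... | inj₂ refl = trans (cong s (sym (+-identityʳ _))) (trans (agree 0 (s≤s z≤n)) (sym sk≡c))
... | no  c≢y  =
  block 1≤n const (λ e → c≢y (trans (sym sk≡c) (trans (sym e) sk+n≡y)))
        (Blocks-runsAux ys (s≤s z≤n) sk+n≡y const₁
                        (λ i i< → trans (cong s (+-assoc (k + n) 1 i)) (agree (suc i) (s≤s i<)))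
                        (λ e → ne (trans (cong s (sym (+-assoc (k + n) 1 (length ys)))) e)))
  where
  sk+n≡y : s (k + n) ≡ y
  sk+n≡y = trans (cong s (sym (+-identityʳ _))) (agree 0 (s≤s z≤n))
  const₁ : Constant s (k + n) 1
  const₁ zero    _       = cong s (+-identityʳ _)
  const₁ (suc _) (s≤s ())

Blocks-runLengths : ∀ {s} xs → (∀ i → i < length xs → s i ≡ at S.+ xs i) →
                    s (length xs) ≢ lastOr S.+ xs → Blocks s 0 (runLengths xs)
Blocks-runLengths []       _     _  = done
Blocks-runLengths (y ∷ ys) agree ne =
  Blocks-runsAux ys (s≤s z≤n) (agree 0 (s≤s z≤n)) const₁ (λ i i< → agree (suc i) (s≤s i<)) ne
  where
  const₁ : Constant _ 0 1
  const₁ zero    _       = refl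
  const₁ (suc _) (s≤s ())

applyUpTo-at : ∀ (c : Sign) f → applyUpTo (at c f) (length f) ≡ f
applyUpTo-at c []      = refl
applyUpTo-at c (x ∷ f) = cong (x ∷_) (applyUpTo-at c f)

at-length : ∀ (c : Sign) f → at c f (length f) ≡ c
at-length c []      = refl
at-length c (x ∷ f) = at-length c f

at-middle : ∀ (d : Sign) u c v → at d (u ++ c ∷ v) (length u) ≡ c
at-middle d []      c v = refl
at-middle d (x ∷ u) c v = at-middle d u c v

P∞-extension-agrees : ∀ c f i → i < length (P f) → P∞ (at c f) i ≡ at S.+ (P f) i
P∞-extension-agrees c f i = subst (λ p → i < length p → P∞ (at c f) i ≡ at S.+ p i)
  (cong P (applyUpTo-at c f)) (P∞-agrees (at c f) (length f) i)

P∞-extension-next : ∀ c f → P∞ (at c f) (length (P f)) ≡ c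
P∞-extension-next c f = trans
  (subst (λ p → length (P f) < length p → P∞ (at c f) (length (P f)) ≡ at S.+ p (length (P f)))
         next-prefix (P∞-agrees (at c f) (suc (length f)) (length (P f))) (length-foldStep (P f) c))
  (at-middle S.+ (P f) c _)
  where
  next-prefix : P-upTo (at c f) (suc (length f)) ≡ foldStep (P f) c
  next-prefix =
    trans (P-upTo-suc (at c f) (length f)) (cong₂ foldStep (cong P (applyUpTo-at c f)) (at-length c f))

closing : List Sign → Sign
closing f = opposite (lastOr S.+ (P f))

R-FactorOfRuns∞ : ∀ f → FactorOfRuns∞ (R f) (P∞ (at (closing f) f))
R-FactorOfRuns∞ f = 0 , tt , Blocks-runLengths (P f) (P∞-extension-agrees (closing f) f)
  (λ e → s≢opposite[s] _ (trans (sym e) (P∞-extension-next (closing f) f)))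

Factor-R⇒FactorOfRuns∞ : ∀ f {w} → Factor w (R f) → FactorOfRuns∞ w (P∞ (at (closing f) f))
Factor-R⇒FactorOfRuns∞ f {w} (u , v , e) =
  FactorOfRuns∞-++ˡ w (FactorOfRuns∞-++ʳ u (subst (λ x → FactorOfRuns∞ x _) (sym e) (R-FactorOfRuns∞ f)))

theorem8 : ((f : List Sign) (w : List ℕ) → w ≢ [] → Palindrome w → Factor w (R f) → w ∈ allowed)
             × ((f : ℕ → Sign) (w : List ℕ) → w ≢ [] → Palindrome w → FactorOfRuns∞ w (P∞ f) → w ∈ allowed)
theorem8 =
  (λ f w w≢[] pal fac →
     P∞-palindromic-runFactor-allowed (at (closing f) f) w w≢[] pal (Factor-R⇒FactorOfRuns∞ f fac)) ,
  P∞-palindromic-runFactor-allowed
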